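{- Let $T$ be a string, let $F_1,F_2,\dots$ be its greedy LZSE factorization, and let $k\ge1$ with $T[1,p]=F_1\cdots F_k$. Define extended factors: for $1\le i<k$, $E_i=F_iF_{i+1}$ if $F_i\in\{E_1,\dots,E_{i-1}\}$ and $E_i=F_i$ otherwise, and $E_k=F_k$. If $F_{k+1}$ is a copy factor and its leftmost valid source occurrence is $F_i\cdots F_j$ (i.e., among all representations $F_{k+1}=F_{i'}\cdots F_{j'}$ with $1\le i'\le j'\le k$, the one with the smallest $i'$), then $F_{k+1}$ begins with $E_i$.
   Context: An LZSE factorization of $T$ is a sequence of non-empty strings $F_1,\dots,F_f$ with $T=F_1\cdots F_f$, each either a char factor (a single character at its first occurrence in $T$) or a copy factor $F_i=F_l\cdots F_r$ for some $1\le l\le r<i$. The greedy LZSE factorization scans $T$ left to right, at each step taking a char factor if the next character is new, and otherwise the longest prefix of the remaining suffix equal to a concatenation $F_l\cdots F_r$ of consecutive already chosen factors. -}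

module Defs where

open import Data.Nat using (ℕ; zero; suc; _∸_; _≤_; _<_)
open import Data.List using (List; []; _∷_; _++_; concat; take; drop; length; [_])
open import Data.List.Properties using (≡-dec)
open import Data.List.Membership.Propositional using (_∈_; _∉_)
import Data.List.Membership.DecPropositional as DecMem
open import Data.Product using (Σ; ∃; ∃-syntax; _×_; _,_)
open import Relation.Binary.PropositionalEquality using (_≡_)
open import Relation.Binary.Definitions using (DecidableEquality)
open import Relation.Nullary using (yes; no)

-- Strings are lists over an alphabet A.  Indices below are 0-based:
-- factor F_{i+1} of the paper is element i of the factor list.

Prefix : {A : Set} → List A → List A → Set
Prefix {A} F S = Σ (List A) λ t → S ≡ F ++ t

slice : {A : Set} → List (List A) → ℕ → ℕ → List (List A)
slice prev l r = take (suc r ∸ l) (drop l prev)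

IsConcatAt : {A : Set} → List (List A) → ℕ → ℕ → List A → Set
IsConcatAt prev l r G = l ≤ r × r < length prev × G ≡ concat (slice prev l r)

IsCopy : {A : Set} → List (List A) → List A → Set
IsCopy prev G = ∃[ l ] ∃[ r ] IsConcatAt prev l r G

data Step {A : Set} (prev : List (List A)) : List A → List A → Set where
  charStep : ∀ {c s} → c ∉ concat prev → Step prev (c ∷ s) (c ∷ [])
  copyStep : ∀ {c s F} → c ∈ concat prev → IsCopy prev F → Prefix F (c ∷ s)
           → (∀ G → IsCopy prev G → Prefix G (c ∷ s) → length G ≤ length F)
           → Step prev (c ∷ s) F

data GreedyFrom {A : Set} (prev : List (List A)) : List (List A) → Set where
  done : GreedyFrom prev []
  next : ∀ {F Fs} → Step prev (concat (F ∷ Fs)) F → GreedyFrom (prev ++ [ F ]) Fs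
       → GreedyFrom prev (F ∷ Fs)

GreedyLZSE : {A : Set} → List A → List (List A) → Set
GreedyLZSE T Fs = concat Fs ≡ T × GreedyFrom [] Fs

-- Extended factors of F_1..F_k: acc holds E_1..E_{i-1}.
-- E_i = F_i F_{i+1} if F_i ∈ {E_1..E_{i-1}} (i<k), else F_i; E_k = F_k.
extStep : {A : Set} → DecidableEquality A → List (List A) → List A → List (List A) → List (List A)
extStep _≟_ acc F [] = F ∷ []
extStep _≟_ acc F (G ∷ rest) with DecMem._∈?_ (≡-dec _≟_) F acc
... | yes _ = (F ++ G) ∷ extStep _≟_ (acc ++ [ F ++ G ]) G rest
... | no  _ = F ∷ extStep _≟_ (acc ++ [ F ]) G rest

extFrom : {A : Set} → DecidableEquality A → List (List A) → List (List A) → List (List A)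
extFrom _≟_ acc [] = []
extFrom _≟_ acc (F ∷ rest) = extStep _≟_ acc F rest

extended : {A : Set} → DecidableEquality A → List (List A) → List (List A)
extended _≟_ Fs = extFrom _≟_ [] Fs

{-# OPTIONS --safe #-}
-- If the extended factor E_i is a single factor F_i there is nothing to show, since the
-- source F_i ⋯ F_j of F begins with F_i.  Otherwise E_i = F_i F_{i+1} where F_i equals an
-- earlier extended factor E_m, m < i, and every E_m is a concatenation of consecutive
-- factors starting at F_m.  Then F = F_i alone would have a source starting at m < i,
-- contradicting leftmostness; so j > i and F begins with F_i F_{i+1}.
module Submission where

open import Defs
open import Data.Nat using (ℕ; zero; suc; _+_; _∸_; _≤_; _<_; z≤n; s≤s)
open import Data.Nat.Properties using (+-suc; +-identityʳ; +-∸-assoc; m+n∸n≡m; n<1+n; n≤1+n; ≤-refl; m≤n⇒m≤1+n; ≤-<-trans; <⇒≱)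
open import Data.List using (List; []; _∷_; _++_; drop; take; concat; length; [_])
open import Data.List.Properties using (≡-dec; ++-identityʳ; ++-assoc)
open import Data.List.Relation.Unary.All as All using (All; []; _∷_)
open import Data.List.Relation.Unary.All.Properties using (∷ʳ⁺)
import Data.List.Membership.DecPropositional as DecMem
open import Data.Product using (∃₂; ∃-syntax; _×_; _,_)
open import Data.Empty using (⊥-elim)
open import Relation.Nullary using (yes; no)
open import Relation.Binary.PropositionalEquality using (_≡_; refl; sym; trans; cong; subst)
open import Relation.Binary.Definitions using (DecidableEquality)

module _ {B : Set} where

  drop-∷⇒< : ∀ n (xs : List B) {y ys} → drop n xs ≡ y ∷ ys → n < length xs
  drop-∷⇒< zero    (x ∷ xs) _  = s≤s z≤n
  drop-∷⇒< (suc n) (x ∷ xs) eq = s≤s (drop-∷⇒< n xs eq)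

  drop-suc-∷ : ∀ n (xs : List B) {y ys} → drop n xs ≡ y ∷ ys → drop (suc n) xs ≡ ys
  drop-suc-∷ zero    (x ∷ xs) refl = refl
  drop-suc-∷ (suc n) (x ∷ xs) eq   = drop-suc-∷ n xs eq

  <length⇒drop-∷ : ∀ n (xs : List B) → n < length xs → ∃₂ λ y ys → drop n xs ≡ y ∷ ys
  <length⇒drop-∷ zero    (x ∷ xs) _       = x , xs , refl
  <length⇒drop-∷ (suc n) (x ∷ xs) (s≤s p) = <length⇒drop-∷ n xs p

module _ {A : Set} (P : List (List A)) where

  slice-∷ : ∀ {l r X rest} → drop l P ≡ X ∷ rest → l ≤ r → slice P l r ≡ X ∷ take (r ∸ l) rest
  slice-∷ {l} {r} eq l≤r rewrite +-∸-assoc 1 l≤r | eq = refl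

  isConcatAt-single : ∀ {n X rest} → drop n P ≡ X ∷ rest → IsConcatAt P n n X
  isConcatAt-single {n} {X} eq rewrite m+n∸n≡m 1 n | eq =
    ≤-refl , drop-∷⇒< n P eq , sym (++-identityʳ X)

  isConcatAt-pair : ∀ {n X G rest} → drop n P ≡ X ∷ G ∷ rest → IsConcatAt P n (suc n) (X ++ G)
  isConcatAt-pair {n} {X} {G} eq rewrite m+n∸n≡m 2 n | eq | ++-identityʳ G =
    n≤1+n n , drop-∷⇒< (suc n) P (drop-suc-∷ n P eq) , refl

  ConcatBefore : ℕ → List A → Set
  ConcatBefore n X = ∃₂ λ m r → m < n × IsConcatAt P m r X

  ConcatBefore-suc : ∀ {n X} → ConcatBefore n X → ConcatBefore (suc n) X
  ConcatBefore-suc (m , r , m<n , c) = m , r , m≤n⇒m≤1+n m<n , c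

  All-ConcatBefore-∷ʳ : ∀ {n r acc E} → All (ConcatBefore n) acc → IsConcatAt P n r E →
    All (ConcatBefore (suc n)) (acc ++ [ E ])
  All-ConcatBefore-∷ʳ {n} sourced c = ∷ʳ⁺ (All.map ConcatBefore-suc sourced) (n , _ , n<1+n n , c)

  -- X ∷ rest are the factors from position n on; E is a candidate for the extended factor there.
  data Extension (n : ℕ) (X : List A) : List (List A) → List A → Set where
    single : ∀ {rest} → Extension n X rest X
    joined : ∀ {G rest} → ConcatBefore n X → Extension n X (G ∷ rest) (X ++ G)

  data Extensions : ℕ → List (List A) → List (List A) → Set where
    []  : ∀ {n} → Extensions n [] []
    _∷_ : ∀ {n X rest E Es} → Extension n X rest E → Extensions (suc n) rest Es →
          Extensions n (X ∷ rest) (E ∷ Es)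

  lookup-Extensions : ∀ {n Xs Es} → Extensions n Xs Es → ∀ d {Y rest} → drop d Xs ≡ Y ∷ rest →
    ∃₂ λ E tl → drop d Es ≡ E ∷ tl × Extension (n + d) Y rest E
  lookup-Extensions {n} (e ∷ es) zero    refl rewrite +-identityʳ n = _ , _ , refl , e
  lookup-Extensions {n} (e ∷ es) (suc d) eq   rewrite +-suc n d     = lookup-Extensions es d eq

  Leftmost : ℕ → List A → Set
  Leftmost i F = ∀ i' j' → IsConcatAt P i' j' F → i ≤ i'

  leftmost-extension-isPrefix : ∀ {i Y rest E F} t → Extension i Y rest E → Leftmost i F →
    F ≡ Y ++ concat (take t rest) → Prefix E F
  leftmost-extension-isPrefix t single _ F≡ = _ , F≡
  leftmost-extension-isPrefix {Y = Y} zero (joined (m , r , m<i , c)) leftmost F≡ =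
    ⊥-elim (<⇒≱ m<i (leftmost m r (subst (IsConcatAt P m r) (sym (trans F≡ (++-identityʳ Y))) c)))
  leftmost-extension-isPrefix {Y = Y} {rest = G ∷ rest} (suc t) (joined _) _ F≡ =
    _ , trans F≡ (sym (++-assoc Y G _))

  module _ (_≟_ : DecidableEquality A) where

    extStep-extensions : ∀ {n acc X rest} → drop n P ≡ X ∷ rest → All (ConcatBefore n) acc →
      Extensions n (X ∷ rest) (extStep _≟_ acc X rest)
    extStep-extensions {rest = []} _ _ = single ∷ []
    extStep-extensions {n} {acc} {X} {G ∷ rest} eq sourced
      with DecMem._∈?_ (≡-dec _≟_) X acc
    ... | yes X∈acc = joined (All.lookup sourced X∈acc)
                    ∷ extStep-extensions (drop-suc-∷ n P eq) (All-ConcatBefore-∷ʳ sourced (isConcatAt-pair eq))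
    ... | no _      = single
                    ∷ extStep-extensions (drop-suc-∷ n P eq) (All-ConcatBefore-∷ʳ sourced (isConcatAt-single eq))

extended-extensions : ∀ {A : Set} (_≟_ : DecidableEquality A) (P : List (List A)) →
  Extensions P 0 P (extended _≟_ P)
extended-extensions _≟_ []         = []
extended-extensions _≟_ (X ∷ rest) = extStep-extensions (X ∷ rest) _≟_ refl []

mainTheorem6 : (A : Set) (_≟_ : DecidableEquality A) (T : List A) (Fs : List (List A)) →
    GreedyLZSE T Fs →
    (k : ℕ) → 1 ≤ k →
    (pre : List (List A)) (F : List A) (post : List (List A)) →
    Fs ≡ pre ++ (F ∷ post) → length pre ≡ k →
    (i j : ℕ) → IsConcatAt pre i j F →
    (∀ i' j' → IsConcatAt pre i' j' F → i ≤ i') →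
    ∃[ E ] ∃[ tl ] (drop i (extended _≟_ pre) ≡ E ∷ tl × Prefix E F)
mainTheorem6 A _≟_ T Fs _ k _ pre F post _ _ i j (i≤j , j<len , F≡) leftmost
  with <length⇒drop-∷ i pre (≤-<-trans i≤j j<len)
... | Y , rest , dropY with lookup-Extensions pre (extended-extensions _≟_ pre) i dropY
... | E , tl , dropE , ext =
  E , tl , dropE ,
  leftmost-extension-isPrefix pre (j ∸ i) ext leftmost (trans F≡ (cong concat (slice-∷ pre dropY i≤j)))
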